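{- Assume that, during a run of Algorithm 2, the candidate invariants $I$ generated at each iteration are conjunctions of clauses which contain, up to renaming of the variables, only terms in a given finite family $\mathsf{Ter}$ of terms. Then the algorithm terminates, either returning an inductive invariant $I$ or after detecting that $\mathsf{Init}\not\models_{\mathcal{T}_S}I$ for the current candidate $I$.
   Context: A transition constraint system $T=(\Sigma_S,\mathsf{Init},\mathsf{Update})$ with background theory $\mathcal{T}_S$: $\Sigma_S$ is a signature, $\mathsf{Init}$ a formula describing initial states, $\mathsf{Update}$ a formula over $\Sigma_S$ and primed copies $f'$ of updated symbols. $\phi'$ replaces each updated symbol $f$ in $\phi$ by $f'$. $I$ is an inductive invariant if $\mathsf{Init}\models_{\mathcal{T}_S}I$ and $I\wedge\mathsf{Update}\models_{\mathcal{T}_S}I'$. Algorithm 2 (input $T$, $\Sigma_P\subseteq\Sigma_S$, universal $\Psi$ over $\Sigma_P$): $I:=\Psi$; while $I$ is not an inductive invariant: if $\mathsf{Init}\not\models_{\mathcal{T}_S}I$ return ``no universal inductive invariant over $\Sigma_P$ entails $\Psi$''; if $I$ is not preserved under $\mathsf{Update}$, let $\Gamma$ be a universal formula over $\Sigma_P$ obtained by eliminating all primed symbols and all symbols not in $\Sigma_P$ from $I\wedge\mathsf{Update}\wedge\neg I'$ (by hierarchical symbol elimination and negation), such that $I\wedge\Gamma\wedge\mathsf{Update}\wedge\neg I'$ is unsatisfiable modulo $\mathcal{T}_S$, and set $I:=I\wedge\Gamma$; on exit return $I$. -}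

module Defs where

open import Data.Nat using (ℕ; zero; suc)
open import Data.List using (List; _++_)
open import Data.List.Relation.Unary.All using (All)
open import Data.List.Relation.Unary.Any using (Any)
open import Data.List.Membership.Propositional using (_∈_)
open import Data.Maybe using (Maybe; just; nothing)
open import Data.Product using (Σ; ∃; _×_; _,_)
open import Relation.Nullary using (¬_; Dec; yes; no)

record Setting : Set₁ where
  field
    -- T_S-models of the signature Σ_S (a "state")
    State   : Set
    -- clauses over Σ_P (implicitly universally quantified)
    Clause  : Set
    ⟦_⟧     : Clause → State → Set
    bivalent : ∀ c s → Dec (⟦ c ⟧ s)
    Init    : State → Set
    -- Update relates the interpretation of the unprimed symbols (first
    -- state) with that of the primed symbols (second state)
    Update  : State → State → Set
    Term    : Set
    termsOf : Clause → List Term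
    -- c ≈ʳ d : c is obtained from d by a renaming of variables
    _≈ʳ_    : Clause → Clause → Set
    renaming-sound : ∀ {c d} → c ≈ʳ d → ∀ s → (⟦ c ⟧ s → ⟦ d ⟧ s) × (⟦ d ⟧ s → ⟦ c ⟧ s)
    finite-clauses : (Ter : List Term) →
      Σ (List Clause) λ Cls → ∀ c → All (_∈ Ter) (termsOf c) → Any (c ≈ʳ_) Cls

module _ (S : Setting) where
  open Setting S

  Formula : Set
  Formula = List Clause

  Holds : Formula → State → Set
  Holds I s = All (λ c → ⟦ c ⟧ s) I

  InitViol : Formula → Set
  InitViol I = Σ State λ s → Init s × ¬ Holds I s

  PresViol : Formula → Set
  PresViol I = Σ State λ s → Σ State λ s' → Holds I s × Update s s' × ¬ Holds I s'

  Inductive : Formula → Set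
  Inductive I = (∀ s → Init s → Holds I s)
              × (∀ s s' → Holds I s → Update s s' → Holds I s')

  data Result : Set where
    inv   : Formula → Result
    noInv : Formula → Result

  module Algorithm2
    (Ψ       : Formula)
    (decInit : ∀ I → Dec (InitViol I))
    (decPres : ∀ I → Dec (PresViol I))
    (elim    : Formula → Formula)
    where

    data Reachable : Formula → Set where
      start : Reachable Ψ
      next  : ∀ {I} → Reachable I → ¬ InitViol I → PresViol I →
              Reachable (I ++ elim I)

    -- the loop, run for at most n iterations ("nothing" = not yet finished)
    run : ℕ → Formula → Maybe Result
    run zero    I = nothing
    run (suc n) I with decInit I | decPres I
    ... | yes _ | _     = just (noInv I)
    ... | no _  | no _  = just (inv I)
    ... | no _  | yes _ = run n (I ++ elim I)

module Submission where

open import Defs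
open import Data.Nat using (ℕ; zero; suc; _+_; _≤_; _<_)
open import Data.Nat.Properties using (+-identityʳ; +-suc; ≤-refl; <⇒≱)
open import Data.List using (List; _++_; length; lookup)
open import Data.List.Relation.Unary.All using (All; all?) renaming (lookup to lookupᴬ)
open import Data.List.Relation.Unary.Any using (index)
open import Data.List.Relation.Unary.Any.Properties using (lookup-index)
open import Data.List.Relation.Unary.All.Properties using (++⁺; ++⁻ˡ; ¬All⇒Any¬)
open import Data.List.Membership.Propositional using (_∈_; find)
open import Data.List.Membership.Propositional.Properties using (∈-++⁺ʳ)
open import Data.Fin using (Fin)
import Data.Fin as Fin
open import Data.Fin.Properties using (injective⇒≤)
open import Data.Vec.Functional using (_∷_)
open import Data.Maybe using (just)
open import Data.Product using (Σ; _×_; _,_; proj₁; proj₂)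
open import Data.Sum using (_⊎_; inj₁; inj₂)
open import Function.Definitions using (Injective)
open import Relation.Nullary using (¬_; Dec; yes; no; contradiction)
open import Relation.Binary.PropositionalEquality using (_≡_; _≢_; refl; sym; subst; cong)

-- Each failed preservation check makes elimination add a clause that is false at the
-- pre-state of the counterexample, where every clause of the current candidate holds.
-- So the clause is not equivalent to any earlier one. Every clause is, up to renaming,
-- one of the finitely many clauses over Ter, so the number of pairwise inequivalent
-- clauses ever added is bounded and the loop stops after at most that many rounds.

∷-injective : ∀ {n} {A : Set} {x : A} {h : Fin n → A} →
  Injective _≡_ _≡_ h → (∀ i → h i ≢ x) → Injective _≡_ _≡_ (x ∷ h)
∷-injective inj fresh {Fin.zero}  {Fin.zero}  _  = refl
∷-injective inj fresh {Fin.zero}  {Fin.suc j} eq = contradiction (sym eq) (fresh j)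
∷-injective inj fresh {Fin.suc i} {Fin.zero}  eq = contradiction eq (fresh i)
∷-injective inj fresh {Fin.suc i} {Fin.suc j} eq = cong Fin.suc (inj eq)

module _ (S : Setting) where
  open Setting S

  holds? : ∀ I s → Dec (Holds S I s)
  holds? I s = all? (λ c → bivalent c s) I

  inductive-if-no-violation : ∀ {I} → ¬ InitViol S I → ¬ PresViol S I → Inductive S I
  inductive-if-no-violation {I} ¬init ¬pres = initial , preserved
    where
    initial : ∀ s → Init s → Holds S I s
    initial s init with holds? I s
    ... | yes holds = holds
    ... | no ¬holds = contradiction (s , init , ¬holds) ¬init

    preserved : ∀ s s' → Holds S I s → Update s s' → Holds S I s'
    preserved s s' holds update with holds? I s'
    ... | yes holds' = holds'
    ... | no ¬holds' = contradiction (s , s' , holds , update , ¬holds') ¬pres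

  Equivalent : Clause → Clause → Set
  Equivalent c d = ∀ s → (⟦ c ⟧ s → ⟦ d ⟧ s) × (⟦ d ⟧ s → ⟦ c ⟧ s)

  module Classes (Ter : List Term) where

    representatives : List Clause
    representatives = proj₁ (finite-clauses Ter)

    m : ℕ
    m = length representatives

    representative : Fin m → Clause
    representative = lookup representatives

    OverTer : Clause → Set
    OverTer c = Σ Clause λ d → (c ≈ʳ d) × All (_∈ Ter) (termsOf d)

    classOf : ∀ {c} → OverTer c → Fin m
    classOf (d , _ , d-over) = index (proj₂ (finite-clauses Ter) d d-over)

    classOf-equivalent : ∀ {c} (over : OverTer c) → Equivalent c (representative (classOf over))
    classOf-equivalent (d , c≈d , d-over) s =
      (λ c-true → d⇒r (c⇒d c-true)) , (λ r-true → d⇒c (r⇒d r-true))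
      where
      d≈r = lookup-index (proj₂ (finite-clauses Ter) d d-over)
      c⇒d = proj₁ (renaming-sound c≈d s)
      d⇒c = proj₂ (renaming-sound c≈d s)
      d⇒r = proj₁ (renaming-sound d≈r s)
      r⇒d = proj₂ (renaming-sound d≈r s)

  module Run
    (Ψ       : Formula S)
    (decInit : ∀ I → Dec (InitViol S I))
    (decPres : ∀ I → Dec (PresViol S I))
    (elim    : Formula S → Formula S)
    where
    open Algorithm2 S Ψ decInit decPres elim

    module Termination
      (elim-blocks : ∀ I → Reachable I → PresViol S I →
        ¬ (Σ State λ s → Σ State λ s' →
             Holds S (I ++ elim I) s × Update s s' × ¬ Holds S I s'))
      (Ter : List Term)
      (over-Ter : ∀ I → Reachable I → All (Classes.OverTer Ter) I)
      where
      open Classes Ter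

      Outcome : ℕ → Formula S → Set
      Outcome n I = Σ (Formula S) λ J →
          (run n I ≡ just (inv J) × Inductive S J)
        ⊎ (run n I ≡ just (noInv J) × InitViol S J)

      record Entailed (k : ℕ) (I : Formula S) : Set where
        field
          classes  : Fin k → Fin m
          distinct : Injective _≡_ _≡_ classes
          entailed : ∀ i s → Holds S I s → ⟦ representative (classes i) ⟧ s
      open Entailed

      nothing-entailed : Entailed 0 Ψ
      nothing-entailed = record { classes = λ () ; distinct = λ {} ; entailed = λ () }

      entailed-≤ : ∀ {k I} → Entailed k I → k ≤ m
      entailed-≤ e = injective⇒≤ (distinct e)

      elim-falsified-at-pre-state : ∀ {I} → Reachable I → ((s , s' , _) : PresViol S I) →
        Σ Clause λ c → c ∈ elim I × ¬ ⟦ c ⟧ s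
      elim-falsified-at-pre-state {I} reach viol@(s , s' , holds , update , ¬holds') =
        find (¬All⇒Any¬ (λ c → bivalent c s) (elim I) elim-true⇒blocked)
        where
        elim-true⇒blocked : ¬ Holds S (elim I) s
        elim-true⇒blocked elim-true =
          elim-blocks I reach viol (s , s' , ++⁺ holds elim-true , update , ¬holds')

      entailed-step : ∀ {k I} (reach : Reachable I) (¬init : ¬ InitViol S I)
        (viol : PresViol S I) → Entailed k I → Entailed (suc k) (I ++ elim I)
      entailed-step {I = I} reach ¬init viol@(s , _ , holds , _) e = record
        { classes  = new ∷ classes e
        ; distinct = ∷-injective (distinct e) fresh
        ; entailed = entailed′
        }
        where
        reach′ = next reach ¬init viol
        falsified = elim-falsified-at-pre-state reach viol
        c = proj₁ falsified
        c∈ : c ∈ I ++ elim I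
        c∈ = ∈-++⁺ʳ I (proj₁ (proj₂ falsified))
        over = lookupᴬ (over-Ter _ reach′) c∈
        new = classOf over

        fresh : ∀ i → classes e i ≢ new
        fresh i eq = proj₂ (proj₂ falsified)
          (proj₂ (classOf-equivalent over s)
            (subst (λ j → ⟦ representative j ⟧ s) eq (entailed e i s holds)))

        entailed′ : ∀ i t → Holds S (I ++ elim I) t → ⟦ representative ((new ∷ classes e) i) ⟧ t
        entailed′ Fin.zero    t holds′ = proj₁ (classOf-equivalent over t) (lookupᴬ holds′ c∈)
        entailed′ (Fin.suc i) t holds′ = entailed e i t (++⁻ˡ I holds′)

      terminates : ∀ n {k I} → m < k + n → Reachable I → Entailed k I → Outcome n I
      terminates zero    {k} m<k+0 _ e =
        contradiction (entailed-≤ e) (<⇒≱ (subst (m <_) (+-identityʳ k) m<k+0))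
      terminates (suc n) {k} {I} m<k+n reach e with decInit I | decPres I
      ... | yes init-viol | _         = I , inj₂ (refl , init-viol)
      ... | no ¬init      | no ¬pres  = I , inj₁ (refl , inductive-if-no-violation ¬init ¬pres)
      ... | no ¬init      | yes viol  =
        terminates n (subst (m <_) (+-suc k n) m<k+n)
          (next reach ¬init viol) (entailed-step reach ¬init viol e)

lemma18 : (S : Setting) → let open Setting S in
    (Ψ : Formula S)
    (decInit : ∀ I → Dec (InitViol S I))
    (decPres : ∀ I → Dec (PresViol S I))
    (elim : Formula S → Formula S) →
    let open Algorithm2 S Ψ decInit decPres elim in
    (∀ I → Reachable I → PresViol S I →
      ¬ (Σ State λ s → Σ State λ s' →
           Holds S (I ++ elim I) s × Update s s' × ¬ Holds S I s')) →
    (Ter : List Term) →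
    (∀ I → Reachable I →
      All (λ c → Σ Clause λ d → (c ≈ʳ d) × All (_∈ Ter) (termsOf d)) I) →
    Σ ℕ λ n → Σ (Formula S) λ I →
      (run n Ψ ≡ just (inv I) × Inductive S I)
      ⊎ (run n Ψ ≡ just (noInv I) × InitViol S I)
lemma18 S Ψ decInit decPres elim elim-blocks Ter over-Ter =
  suc m , terminates (suc m) ≤-refl Algorithm2.start nothing-entailed
  where
  open Classes S Ter using (m)
  open Run.Termination S Ψ decInit decPres elim elim-blocks Ter over-Ter
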